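{- Let $\mathfrak{g}$ be of type $E_7^{(1)}$ and $s\ge1$. Let $\alpha^{(1)} = 2\alpha_1+3\alpha_2+4\alpha_3+6\alpha_4+5\alpha_5+4\alpha_6+2\alpha_7 = \Lambda_6$ and $\alpha^{(2)} = \alpha_2+\alpha_3+2\alpha_4+2\alpha_5+2\alpha_6+\alpha_7 = \Lambda_6-\Lambda_1$. Then the highest weight rigged configurations of $B^{6,s}$ are exactly $\nu(k_1\ast[\alpha^{(1)}]+k_2\ast[\alpha^{(2)}])$ with all riggings $0$, for $k_1,k_2\in\mathbb{Z}_{\ge0}$ with $k_1+k_2\le s$; the one indexed by $(k_1,k_2)$ has weight $(s-k_1-k_2)\Lambda_6+k_2\Lambda_1$ and cocharge $2k_1+k_2$. Consequently \[ \mathrm{RC}(B^{6,s}) \cong \bigoplus_{\substack{k_1+k_2\le s\\ k_1,k_2\in\mathbb{Z}_{\ge0}}} \mathrm{RC}(B^{6,s}; (s-k_1-k_2)\Lambda_6 + k_2\Lambda_1). \]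
   Context: Finite type $E_7$ with Bourbaki labeling: edges $1$–$3$, $3$–$4$, $4$–$5$, $5$–$6$, $6$–$7$, $2$–$4$; $I_0=\{1,\dots,7\}$, Cartan matrix $(A_{ab})$, simple roots $\alpha_a$, fundamental weights $\Lambda_a$. Rigged configurations for $B^{r,s}$: a configuration $\nu=(\nu^{(a)})_{a\in I_0}$ is a tuple of partitions, $m_i^{(a)}$ the number of rows of length $i$ in $\nu^{(a)}$. Vacancy numbers: $p_i^{(a)} = \delta_{ar}\min(i,s) - \sum_{b\in I_0}A_{ab}\sum_{j\ge1}\min(i,j)m_j^{(b)}$. A rigged configuration $(\nu,J)$ assigns to each row of $\nu^{(a)}$ of length $i$ an integer rigging $x\le p_i^{(a)}$ (a multiset for rows of equal length); it is highest weight if all riggings are $\ge 0$. Weight: $s\Lambda_r-\sum_a|\nu^{(a)}|\alpha_a$. Cocharge: $\mathrm{cc}(\nu,J)=\frac12\sum_{a,b\in I_0}\sum_{i,j}A_{ab}\min(i,j)m_i^{(a)}m_j^{(b)}+\sum(\text{all riggings})$. $\mathrm{RC}(B^{r,s})$ is a $U_q(\mathfrak{g}_0)$-crystal whose highest weight elements are the highest weight rigged configurations, each of weight $\lambda$ generating a component isomorphic to $B(\lambda)$; $\mathrm{RC}(B^{r,s};\lambda)$ is the union of components with highest weight $\lambda$. For $\beta^{(k)}=\sum_a c_a^{(k)}\alpha_a$ with $c_a^{(k)}\in\mathbb{Z}_{\ge0}$, $\nu(\beta^{(1)},\dots,\beta^{(\ell)})$ is the configuration in which $\nu^{(a)}$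 has columns of heights $c_a^{(1)},\dots,c_a^{(\ell)}$ (sorted, zeros omitted); $k\ast[\beta]$ is $k$ copies of $\beta$ and $+$ is concatenation. -}

module Defs where

open import Data.Nat as ℕ using (ℕ; zero; suc; _⊔_; _⊓_)
open import Data.Integer as ℤ using (ℤ; +_; _-_; _*_; _+_; _≤_)
open import Data.Integer.DivMod using (_/ℕ_)
open import Data.Fin using (Fin; toℕ; #_)
open import Data.Nat.ListAction using (sum)
open import Data.List using (List; []; _∷_; map; length; allFin; applyUpTo; filter; foldr; concatMap)
open import Data.List.Relation.Unary.All using (All)
open import Data.Product using (_×_; _,_; proj₁; proj₂)
open import Relation.Nullary using (Dec)
open import Data.Nat using (_≤?_)

-- Type E7, Bourbaki labelling.  Node with Bourbaki label a (1..7) is the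
-- element  # (a - 1)  of  Fin 7.

Node : Set
Node = Fin 7

label : Node → ℕ
label a = suc (toℕ a)

adjℕ : ℕ → ℕ → ℕ
adjℕ 1 3 = 1
adjℕ 3 1 = 1
adjℕ 3 4 = 1
adjℕ 4 3 = 1
adjℕ 4 5 = 1
adjℕ 5 4 = 1
adjℕ 5 6 = 1
adjℕ 6 5 = 1
adjℕ 6 7 = 1
adjℕ 7 6 = 1
adjℕ 2 4 = 1
adjℕ 4 2 = 1
adjℕ _ _ = 0

δℕ : ℕ → ℕ → ℕ
δℕ zero zero = 1
δℕ zero (suc _) = 0
δℕ (suc _) zero = 0
δℕ (suc m) (suc n) = δℕ m n

A : Node → Node → ℤ
A a b = + (2 ℕ.* δℕ (label a) (label b)) - + adjℕ (label a) (label b)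

δ : Node → Node → ℕ
δ a b = δℕ (label a) (label b)

sumℤ : List ℤ → ℤ
sumℤ = foldr _+_ (+ 0)

sumNodes : (Node → ℤ) → ℤ
sumNodes f = sumℤ (map f (allFin 7))

-- A row is a pair (length i, rigging x).  A (possibly invalid) rigged
-- configuration assigns to each node the list of rows of ν^(a) together
-- with their riggings; the list is regarded up to permutation
-- (the multiset of (row, rigging) pairs).

Row : Set
Row = ℕ × ℤ

RConf : Set
RConf = Node → List Row

minSum : ℕ → List Row → ℤ
minSum i rows = + sum (map (λ r → i ⊓ proj₁ r) rows)

vacancy : Node → ℕ → RConf → Node → ℕ → ℤ
vacancy r s ν a i =
  + (δ a r ℕ.* (i ⊓ s)) - sumNodes (λ b → A a b * minSum i (ν b))

IsRC : Node → ℕ → RConf → Set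
IsRC r s ν = ∀ a → All (λ row → (1 ℕ.≤ proj₁ row) × (proj₂ row ≤ vacancy r s ν a (proj₁ row))) (ν a)

IsHWRC : Node → ℕ → RConf → Set
IsHWRC r s ν = IsRC r s ν × (∀ a → All (λ row → + 0 ≤ proj₂ row) (ν a))

size : List Row → ℕ
size rows = sum (map proj₁ rows)

-- weight  sΛ_r - Σ_a |ν^(a)| α_a,  written in the basis of fundamental
-- weights (α_a = Σ_b A_{ab} Λ_b): coefficient of Λ_b
weight : Node → ℕ → RConf → Node → ℤ
weight r s ν b = + (s ℕ.* δ b r) - sumNodes (λ a → + size (ν a) * A a b)

quadForm : RConf → ℤ
quadForm ν = sumNodes (λ a → sumNodes (λ b →
  A a b * sumℤ (map (λ row → minSum (proj₁ row) (ν b)) (ν a))))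

sumRiggings : RConf → ℤ
sumRiggings ν = sumNodes (λ a → sumℤ (map proj₂ (ν a)))

-- cocharge = (1/2) quadForm + Σ riggings   (quadForm is always even)
cocharge : RConf → ℤ
cocharge ν = (quadForm ν /ℕ 2) + sumRiggings ν

-- ν(β^(1),...,β^(ℓ)): ν^(a) has columns of heights c_a^(1),...,c_a^(ℓ).

RootVec : Set
RootVec = Node → ℕ     -- β = Σ_a β(a) α_a

countGeq : ℕ → List ℕ → ℕ
countGeq i cs = length (filter (λ c → i ≤? c) cs)

maxL : List ℕ → ℕ
maxL = foldr _⊔_ 0

-- row lengths of the partition with given column heights (zeros ignored)
rowsFromColumns : List ℕ → List ℕ
rowsFromColumns cs = applyUpTo (λ k → countGeq (suc k) cs) (maxL cs)

νZero : List RootVec → RConf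
νZero βs a = map (λ i → (i , + 0)) (rowsFromColumns (map (λ β → β a) βs))

replicateL : {X : Set} → ℕ → X → List X
replicateL zero x = []
replicateL (suc n) x = x ∷ replicateL n x

αone : RootVec
αone a = coeff (label a)
  where
  coeff : ℕ → ℕ
  coeff 1 = 2
  coeff 2 = 3
  coeff 3 = 4
  coeff 4 = 6
  coeff 5 = 5
  coeff 6 = 4
  coeff 7 = 2
  coeff _ = 0

αtwo : RootVec
αtwo a = coeff (label a)
  where
  coeff : ℕ → ℕ
  coeff 2 = 1
  coeff 3 = 1
  coeff 4 = 2
  coeff 5 = 2
  coeff 6 = 2
  coeff 7 = 1
  coeff _ = 0

candidate : ℕ → ℕ → RConf
candidate k₁ k₂ = νZero (replicateL k₁ αone Data.List.++ replicateL k₂ αtwo)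

node1 node6 : Node
node1 = # 0
node6 = # 5

targetWeight : ℕ → ℕ → ℕ → Node → ℤ
targetWeight s k₁ k₂ b = + ((s ℕ.∸ (k₁ ℕ.+ k₂)) ℕ.* δ b node6 ℕ.+ k₂ ℕ.* δ b node1)

-- At the rows of a highest weight rigged configuration of B^{6,s} the vacancy numbers p_i are nonnegative,
-- and since l p₁ ≥ p_l below the shortest row, so are the p₁. These are the Λ-coefficients of
-- (1 ⊓ s)Λ₆ − Σ_b m_b α_b with m_b the number of rows of ν⁽ᵇ⁾. Inverting the Cartan matrix bounds m by α⁽¹⁾,
-- and a finite check leaves m ∈ {0, α⁽²⁾ = Λ₆ − Λ₁, α⁽¹⁾ = Λ₆}: the first column of ν is empty,
-- α⁽²⁾ or α⁽¹⁾.
-- Removing it gives the same situation for B^{6,s−1}, with the vacancy numbers shifted by Λ₁ after an α⁽²⁾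
-- column (after which only α⁽²⁾ columns fit), so by induction ν = ν(k₁[α⁽¹⁾] + k₂[α⁽²⁾]) with k₁ + k₂ ≤ s.
-- For this shape every vacancy number vanishes at the rows, which forces the riggings to be 0, gives the
-- converse, and makes the weight and the cocharge a direct computation.

module Submission where

open import Defs

module RowLists where
  open import Data.Nat using (ℕ; zero; suc; _+_; _*_; _∸_; _⊓_; _⊔_; _≤_; _<_; z≤n; s≤s; _≤?_)
  open import Data.Nat.Properties
  open import Data.Nat.ListAction using (sum)
  open import Data.Nat.ListAction.Properties using (sum-↭)
  import Data.Nat.Tactic.RingSolver as ℕ-Solver
  open import Data.List using (List; []; _∷_; map; length; _++_; replicate; applyUpTo)
  open import Data.List.Properties using (length-map; length-applyUpTo; map-applyUpTo; filter-accept; filter-none)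
  open import Data.List.Relation.Unary.All as All using (All; []; _∷_)
  open import Data.List.Relation.Binary.Permutation.Propositional
    using (_↭_; prep; ↭-sym; ↭-trans; ↭-reflexive; module PermutationReasoning)
  open import Data.List.Relation.Binary.Permutation.Propositional.Properties using (map⁺; ++⁺ʳ; ↭-length; shift)
  open import Data.Product using (_,_; proj₁)
  open import Relation.Binary.PropositionalEquality

  -- The paper's Q_i(ρ) = Σ_j min(i, ρ_j): the number of cells of ρ in its first i columns.
  Q : ℕ → List ℕ → ℕ
  Q i ρ = sum (map (i ⊓_) ρ)

  Q-zero : ∀ ρ → Q 0 ρ ≡ 0
  Q-zero [] = refl
  Q-zero (l ∷ ρ) = Q-zero ρ

  Q-↭ : ∀ i {ρ σ} → ρ ↭ σ → Q i ρ ≡ Q i σ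
  Q-↭ i p = sum-↭ (map⁺ (i ⊓_) p)

  Q-one : ∀ {ρ} → All (1 ≤_) ρ → Q 1 ρ ≡ length ρ
  Q-one [] = refl
  Q-one (s≤s z≤n ∷ p) = cong suc (Q-one p)

  Q-below : ∀ {l ρ} → All (l ≤_) ρ → Q l ρ ≡ l * length ρ
  Q-below {l} [] = sym (*-zeroʳ l)
  Q-below {l} (p ∷ ps) = trans (cong₂ _+_ (m≤n⇒m⊓n≡m p) (Q-below ps)) (sym (*-suc l _))

  Q-atMost : ∀ {i ρ} → All (_≤ i) ρ → Q i ρ ≡ sum ρ
  Q-atMost [] = refl
  Q-atMost (p ∷ ps) = cong₂ _+_ (m≥n⇒m⊓n≡n p) (Q-atMost ps)

  ⊓-convex : ∀ l x → l ⊓ x ≤ l * (1 ⊓ x)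
  ⊓-convex l zero = ≤-reflexive (trans (⊓-zeroʳ l) (sym (*-zeroʳ l)))
  ⊓-convex l (suc x) = ≤-trans (m⊓n≤m l (suc x)) (≤-reflexive (sym (*-identityʳ l)))

  Q-convex : ∀ l ρ → Q l ρ ≤ l * Q 1 ρ
  Q-convex l [] = z≤n
  Q-convex l (x ∷ ρ) = ≤-trans (+-mono-≤ (⊓-convex l x) (Q-convex l ρ)) (≤-reflexive (sym (*-distribˡ-+ l (1 ⊓ x) (Q 1 ρ))))

  Q-addColumn : ∀ i ρ r → Q (suc i) (map suc ρ ++ replicate r 1) ≡ (length ρ + r) + Q i ρ
  Q-addColumn i [] zero = refl
  Q-addColumn i [] (suc r) = cong₂ _+_ (cong suc (⊓-zeroʳ i)) (Q-addColumn i [] r)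
  Q-addColumn i (l ∷ ρ) r =
    trans (cong (λ q → suc (i ⊓ l + q)) (Q-addColumn i ρ r)) (cong suc (exchange (i ⊓ l) (length ρ + r) (Q i ρ)))
    where
    exchange : ∀ a b c → a + (b + c) ≡ b + (a + c)
    exchange = ℕ-Solver.solve-∀

  Positive : List Row → Set
  Positive = All (λ row → 1 ≤ proj₁ row)

  lengths : List Row → List ℕ
  lengths = map proj₁

  peelRows : List Row → List Row
  peelRows [] = []
  peelRows ((zero , x) ∷ rows) = peelRows rows
  peelRows ((suc zero , x) ∷ rows) = peelRows rows
  peelRows ((suc (suc l) , x) ∷ rows) = (suc l , x) ∷ peelRows rows

  length-peelRows : ∀ rows → length (peelRows rows) ≤ length rows
  length-peelRows [] = z≤n
  length-peelRows ((zero , x) ∷ rows) = m≤n⇒m≤1+n (length-peelRows rows)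
  length-peelRows ((suc zero , x) ∷ rows) = m≤n⇒m≤1+n (length-peelRows rows)
  length-peelRows ((suc (suc l) , x) ∷ rows) = s≤s (length-peelRows rows)

  Q-peelRows : ∀ i {rows} → Positive rows → Q (suc i) (lengths rows) ≡ length rows + Q i (lengths (peelRows rows))
  Q-peelRows i [] = refl
  Q-peelRows i {(suc zero , x) ∷ rows} (_ ∷ p) = cong₂ (λ m q → suc (m + q)) (⊓-zeroʳ i) (Q-peelRows i p)
  Q-peelRows i {(suc (suc l) , x) ∷ rows} (_ ∷ p) =
    trans (cong (λ q → suc (i ⊓ suc l + q)) (Q-peelRows i p)) (cong suc (exchange (i ⊓ suc l) (length rows) _))
    where
    exchange : ∀ a b c → a + (b + c) ≡ b + (a + c)
    exchange = ℕ-Solver.solve-∀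

  lengths-peelRows : ∀ {rows} → Positive rows →
    lengths rows ↭ map suc (lengths (peelRows rows)) ++ replicate (length rows ∸ length (peelRows rows)) 1
  lengths-peelRows [] = ↭-reflexive refl
  lengths-peelRows {(suc zero , x) ∷ rows} (_ ∷ p) = ↭-trans (prep 1 (lengths-peelRows p)) (↭-sym (↭-trans
    (↭-reflexive (cong (λ k → map suc (lengths (peelRows rows)) ++ replicate k 1) (+-∸-assoc 1 (length-peelRows rows))))
    (shift 1 (map suc (lengths (peelRows rows))) _)))
  lengths-peelRows {(suc (suc l) , x) ∷ rows} (_ ∷ p) = prep (suc (suc l)) (lengths-peelRows p)

  All-peelRows : ∀ {P R : Row → Set} {rows} → All P rows → (∀ {l x} → P (suc (suc l) , x) → R (suc l , x)) →
    All R (peelRows rows)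
  All-peelRows [] f = []
  All-peelRows {rows = (zero , x) ∷ rows} (_ ∷ ps) f = All-peelRows ps f
  All-peelRows {rows = (suc zero , x) ∷ rows} (_ ∷ ps) f = All-peelRows ps f
  All-peelRows {rows = (suc (suc l) , x) ∷ rows} (p ∷ ps) f = f p ∷ All-peelRows ps f

  All-≤-maxL : ∀ cs → All (_≤ maxL cs) cs
  All-≤-maxL [] = []
  All-≤-maxL (c ∷ cs) = m≤m⊔n c (maxL cs) ∷ All.map (λ h → ≤-trans h (m≤n⊔m c (maxL cs))) (All-≤-maxL cs)

  maxL-lub : ∀ {c cs} → All (_≤ c) cs → maxL cs ≤ c
  maxL-lub [] = z≤n
  maxL-lub (h ∷ hs) = ⊔-lub h (maxL-lub hs)

  countGeq-cons : ∀ {i c} cs → i ≤ c → countGeq i (c ∷ cs) ≡ suc (countGeq i cs)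
  countGeq-cons cs h = cong length (filter-accept (_ ≤?_) {xs = cs} h)

  countGeq-above : ∀ {i m cs} → All (_≤ m) cs → m < i → countGeq i cs ≡ 0
  countGeq-above hs m<i =
    cong length (filter-none (_ ≤?_) (All.map (λ c≤m i≤c → <-irrefl refl (≤-trans m<i (≤-trans i≤c c≤m))) hs))

  applyUpTo-cong : ∀ {A : Set} {f g : ℕ → A} n → (∀ {k} → k < n → f k ≡ g k) → applyUpTo f n ≡ applyUpTo g n
  applyUpTo-cong zero e = refl
  applyUpTo-cong (suc n) e = cong₂ _∷_ (e (s≤s z≤n)) (applyUpTo-cong n (λ k<n → e (s≤s k<n)))

  applyUpTo-const : ∀ {A : Set} (x : A) n → applyUpTo (λ _ → x) n ≡ replicate n x
  applyUpTo-const x zero = refl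
  applyUpTo-const x (suc n) = cong (x ∷_) (applyUpTo-const x n)

  applyUpTo-+ : ∀ {A : Set} (f : ℕ → A) m r → applyUpTo f (m + r) ≡ applyUpTo f m ++ applyUpTo (λ k → f (m + k)) r
  applyUpTo-+ f zero r = refl
  applyUpTo-+ f (suc m) r = cong (f 0 ∷_) (applyUpTo-+ (λ k → f (suc k)) m r)

  length-rowsFromColumns : ∀ cs → length (rowsFromColumns cs) ≡ maxL cs
  length-rowsFromColumns cs = length-applyUpTo _ (maxL cs)

  rowsFromColumns-cons : ∀ {c cs} → All (_≤ c) cs →
    rowsFromColumns (c ∷ cs) ≡ map suc (rowsFromColumns cs) ++ replicate (c ∸ maxL cs) 1
  rowsFromColumns-cons {c} {cs} hs = begin
      applyUpTo f (c ⊔ m)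
    ≡⟨ cong (applyUpTo f) (trans (m≥n⇒m⊔n≡m m≤c) (sym (m+[n∸m]≡n m≤c))) ⟩
      applyUpTo f (m + (c ∸ m))
    ≡⟨ applyUpTo-+ f m (c ∸ m) ⟩
      applyUpTo f m ++ applyUpTo (λ k → f (m + k)) (c ∸ m)
    ≡⟨ cong₂ _++_ oldRows newRows ⟩
      map suc (rowsFromColumns cs) ++ replicate (c ∸ m) 1 ∎
    where
    open ≡-Reasoning
    m : ℕ
    m = maxL cs
    m≤c : m ≤ c
    m≤c = maxL-lub hs
    f : ℕ → ℕ
    f k = countGeq (suc k) (c ∷ cs)
    oldRows : applyUpTo f m ≡ map suc (rowsFromColumns cs)
    oldRows = trans (applyUpTo-cong m (λ k<m → countGeq-cons cs (≤-trans k<m m≤c)))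
                    (sym (map-applyUpTo (λ k → countGeq (suc k) cs) suc m))
    newRows : applyUpTo (λ k → f (m + k)) (c ∸ m) ≡ replicate (c ∸ m) 1
    newRows = trans (applyUpTo-cong (c ∸ m) (λ {k} k<r →
                trans (countGeq-cons cs (≤-trans (+-monoʳ-< m k<r) (≤-reflexive (m+[n∸m]≡n m≤c))))
                      (cong suc (countGeq-above (All-≤-maxL cs) (s≤s (m≤m+n m k))))))
              (applyUpTo-const 1 (c ∸ m))

  unpeel : ∀ {rows c cs} → Positive rows → length rows ≡ c → All (_≤ c) cs →
    lengths (peelRows rows) ↭ rowsFromColumns cs → lengths rows ↭ rowsFromColumns (c ∷ cs)
  unpeel {rows} {c} {cs} pos refl hs p = begin
      lengths rows
    ↭⟨ lengths-peelRows pos ⟩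
      map suc (lengths (peelRows rows)) ++ replicate (c ∸ length (peelRows rows)) 1
    ↭⟨ ++⁺ʳ _ (map⁺ suc p) ⟩
      map suc (rowsFromColumns cs) ++ replicate (c ∸ length (peelRows rows)) 1
    ≡⟨ cong (λ k → map suc (rowsFromColumns cs) ++ replicate (c ∸ k) 1) peeledRows ⟩
      map suc (rowsFromColumns cs) ++ replicate (c ∸ maxL cs) 1
    ≡⟨ sym (rowsFromColumns-cons hs) ⟩
      rowsFromColumns (c ∷ cs) ∎
    where
    open PermutationReasoning
    peeledRows : length (peelRows rows) ≡ maxL cs
    peeledRows = trans (sym (length-map proj₁ (peelRows rows))) (trans (↭-length p) (length-rowsFromColumns cs))

module Cartan where
  open import Data.Nat as ℕ using (ℕ; zero; suc)
  open import Data.Fin using (Fin; toℕ; zero; suc)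
  open import Data.Fin.Properties using (all?) renaming (_≟_ to _≟ᶠ_)
  open import Data.Integer as ℤ using (ℤ; +_; -[1+_]; _+_; _-_; _*_; _≤_; _≤?_; +≤+)
  open import Data.Integer.Properties as ℤP using (+-*-semiring; _≟_; pos-*)
  open import Algebra.Properties.Semiring.Sum +-*-semiring
    using (sum; sum-cong-≗; sum-replicate-zero; ∑-comm; ∑-distrib-+; *-distribˡ-sum; *-distribʳ-sum)
  open import Data.Integer.Tactic.RingSolver using (solve-∀)
  open import Data.Vec.Functional using (Vector; []; _∷_)
  open import Function using (_∘_)
  open import Relation.Nullary using (Dec; yes; no; ¬_; ¬?; _→-dec_)
  open import Relation.Nullary.Decidable using (True; toWitness)
  open import Relation.Binary.PropositionalEquality

  byComputation : {P : Set} (P? : Dec P) → {True P?} → P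
  byComputation P? {p} = toWitness {a? = P?} p

  sum-nonneg : ∀ {n} {f : Vector ℤ n} → (∀ i → + 0 ≤ f i) → + 0 ≤ sum f
  sum-nonneg {zero} h = ℤP.≤-refl
  sum-nonneg {suc n} h = ℤP.+-mono-≤ (h zero) (sum-nonneg (h ∘ suc))

  sum-nonpos : ∀ {n} {f : Vector ℤ n} → (∀ i → f i ≤ + 0) → sum f ≤ + 0
  sum-nonpos {zero} h = ℤP.≤-refl
  sum-nonpos {suc n} h = ℤP.+-mono-≤ (h zero) (sum-nonpos (h ∘ suc))

  sum-δ : ∀ {n} (a : Fin n) (g : Vector ℤ n) → sum (λ c → + δℕ (toℕ a) (toℕ c) * g c) ≡ g a
  sum-δ {suc n} zero g = begin
      + 1 * g zero + sum (λ c → + 0 * g (suc c))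
    ≡⟨ cong₂ _+_ (ℤP.*-identityˡ (g zero)) (sum-replicate-zero n) ⟩
      g zero + + 0
    ≡⟨ ℤP.+-identityʳ (g zero) ⟩
      g zero ∎
    where open ≡-Reasoning
  sum-δ {suc n} (suc a) g = trans (ℤP.+-identityˡ _) (sum-δ a (g ∘ suc))

  -- (A v)_a, the coefficient of Λ_a in Σ_b v_b α_b.
  cartan : (Node → ℤ) → Node → ℤ
  cartan v a = sumNodes (λ b → A a b * v b)

  cartan-cong : ∀ {v w} → v ≗ w → ∀ a → cartan v a ≡ cartan w a
  cartan-cong e a = sum-cong-≗ (λ b → cong (A a b *_) (e b))

  cartan-+ : ∀ u v a → cartan (λ b → u b + v b) a ≡ cartan u a + cartan v a
  cartan-+ u v a =
    trans (sum-cong-≗ (λ b → ℤP.*-distribˡ-+ (A a b) (u b) (v b))) (∑-distrib-+ (λ b → A a b * u b) (λ b → A a b * v b))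

  cartan-linear : ∀ x u y v a → cartan (λ b → x * u b + y * v b) a ≡ x * cartan u a + y * cartan v a
  cartan-linear x u y v a = begin
      sum (λ b → A a b * (x * u b + y * v b))
    ≡⟨ sum-cong-≗ (λ b → distribute (A a b) x (u b) y (v b)) ⟩
      sum (λ b → x * (A a b * u b) + y * (A a b * v b))
    ≡⟨ ∑-distrib-+ (λ b → x * (A a b * u b)) (λ b → y * (A a b * v b)) ⟩
      sum (λ b → x * (A a b * u b)) + sum (λ b → y * (A a b * v b))
    ≡⟨ sym (cong₂ _+_ (*-distribˡ-sum x (λ b → A a b * u b)) (*-distribˡ-sum y (λ b → A a b * v b))) ⟩
      x * cartan u a + y * cartan v a ∎
    where
    open ≡-Reasoning
    distribute : ∀ c x u y v → c * (x * u + y * v) ≡ x * (c * u) + y * (c * v)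
    distribute = solve-∀

  δ-symmetric : ∀ a b → δ a b ≡ δ b a
  δ-symmetric = byComputation (all? λ a → all? λ b → δ a b ℕ.≟ δ b a)

  A-symmetric : ∀ a b → A a b ≡ A b a
  A-symmetric = byComputation (all? λ a → all? λ b → A a b ≟ A b a)

  A-offDiagonal-nonpos : ∀ a b → ¬ a ≡ b → A a b ≤ + 0
  A-offDiagonal-nonpos = byComputation (all? λ a → all? λ b → ¬? (a ≟ᶠ b) →-dec A a b ≤? + 0)

  cartan-nonpos : ∀ {a} {v : Node → ℤ} → (∀ b → + 0 ≤ v b) → v a ≡ + 0 → cartan v a ≤ + 0
  cartan-nonpos {a} {v} v≥0 va≡0 = sum-nonpos term
    where
    term : ∀ b → A a b * v b ≤ + 0
    term b with a ≟ᶠ b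
    ... | yes refl = ℤP.≤-reflexive (trans (cong (A a a *_) va≡0) (ℤP.*-zeroʳ (A a a)))
    ... | no a≢b = ℤP.*-monoʳ-≤-nonNeg (v b) {{ℤ.nonNegative (v≥0 b)}} (A-offDiagonal-nonpos a b a≢b)

  -- The highest root of E₇; it equals Λ₁.
  θ : RootVec
  θ = 2 ∷ 2 ∷ 3 ∷ 4 ∷ 3 ∷ 2 ∷ 1 ∷ []

  αone≡αtwo+θ : ∀ a → αone a ≡ αtwo a ℕ.+ θ a
  αone≡αtwo+θ = byComputation (all? λ a → αone a ℕ.≟ αtwo a ℕ.+ θ a)

  cartan-αone : ∀ a → cartan (λ b → + αone b) a ≡ + δ a node6
  cartan-αone = byComputation (all? λ a → cartan (λ b → + αone b) a ≟ + δ a node6)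

  cartan-αtwo : ∀ a → cartan (λ b → + αtwo b) a ≡ + δ a node6 - + δ a node1
  cartan-αtwo = byComputation (all? λ a → cartan (λ b → + αtwo b) a ≟ + δ a node6 - + δ a node1)

  cartan-θ : ∀ a → cartan (λ b → + θ b) a ≡ + δ a node1
  cartan-θ = byComputation (all? λ a → cartan (λ b → + θ b) a ≟ + δ a node1)

  inverseCartan×2 : Node → Node → ℕ
  inverseCartan×2 =
    (4 ∷ 4 ∷ 6 ∷ 8 ∷ 6 ∷ 4 ∷ 2 ∷ []) ∷
    (4 ∷ 7 ∷ 8 ∷ 12 ∷ 9 ∷ 6 ∷ 3 ∷ []) ∷
    (6 ∷ 8 ∷ 12 ∷ 16 ∷ 12 ∷ 8 ∷ 4 ∷ []) ∷
    (8 ∷ 12 ∷ 16 ∷ 24 ∷ 18 ∷ 12 ∷ 6 ∷ []) ∷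
    (6 ∷ 9 ∷ 12 ∷ 18 ∷ 15 ∷ 10 ∷ 5 ∷ []) ∷
    (4 ∷ 6 ∷ 8 ∷ 12 ∷ 10 ∷ 8 ∷ 4 ∷ []) ∷
    (2 ∷ 3 ∷ 4 ∷ 6 ∷ 5 ∷ 4 ∷ 3 ∷ []) ∷ []

  inverseCartan×2-inverse : ∀ a c → sumNodes (λ b → + inverseCartan×2 a b * A b c) ≡ + 2 * + δ a c
  inverseCartan×2-inverse =
    byComputation (all? λ a → all? λ c → sumNodes (λ b → + inverseCartan×2 a b * A b c) ≟ + 2 * + δ a c)

  inverseCartan×2-cartan : ∀ v a → sumNodes (λ b → + inverseCartan×2 a b * cartan v b) ≡ + 2 * v a
  inverseCartan×2-cartan v a = begin
      sum (λ b → C a b * sum (λ c → A b c * v c))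
    ≡⟨ sum-cong-≗ (λ b → *-distribˡ-sum (C a b) (λ c → A b c * v c)) ⟩
      sum (λ b → sum (λ c → C a b * (A b c * v c)))
    ≡⟨ ∑-comm (λ b c → C a b * (A b c * v c)) ⟩
      sum (λ c → sum (λ b → C a b * (A b c * v c)))
    ≡⟨ sum-cong-≗ (λ c → trans (sum-cong-≗ (λ b → sym (ℤP.*-assoc (C a b) (A b c) (v c))))
                               (sym (*-distribʳ-sum (v c) (λ b → C a b * A b c)))) ⟩
      sum (λ c → sum (λ b → C a b * A b c) * v c)
    ≡⟨ sum-cong-≗ (λ c → trans (cong (_* v c) (inverseCartan×2-inverse a c)) (ℤP.*-assoc (+ 2) (+ δ a c) (v c))) ⟩
      sum (λ c → + 2 * (+ δ a c * v c))
    ≡⟨ sym (*-distribˡ-sum (+ 2) (λ c → + δ a c * v c)) ⟩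
      + 2 * sum (λ c → + δ a c * v c)
    ≡⟨ cong (+ 2 *_) (sum-δ a v) ⟩
      + 2 * v a ∎
    where
    open ≡-Reasoning
    C : Node → Node → ℤ
    C a b = + inverseCartan×2 a b

  -- The coefficient of Λ_a in tΛ₆ − Σ_b n_b α_b.
  weightCoefficient : ℕ → (Node → ℕ) → Node → ℤ
  weightCoefficient t n a = + (t ℕ.* δ a node6) - cartan (λ b → + n b) a

  weightCoefficient-αone : ∀ a → weightCoefficient 1 αone a ≡ + 0
  weightCoefficient-αone = byComputation (all? λ a → weightCoefficient 1 αone a ≟ + 0)

  weightCoefficient-αtwo : ∀ a → weightCoefficient 1 αtwo a ≡ + δ a node1
  weightCoefficient-αtwo = byComputation (all? λ a → weightCoefficient 1 αtwo a ≟ + δ a node1)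

  δ-≢-node1 : ∀ a → ¬ a ≡ node1 → δ a node1 ≡ 0
  δ-≢-node1 = byComputation (all? λ a → ¬? (a ≟ᶠ node1) →-dec δ a node1 ℕ.≟ 0)

  -- Since 2A⁻¹ ≥ 0 and A(tα⁽¹⁾ − n) = tΛ₆ − An ≥ 0, also 2(tα⁽¹⁾ − n) ≥ 0.
  dominant⇒below-tαone : ∀ t n → (∀ a → + 0 ≤ weightCoefficient t n a) → ∀ a → n a ℕ.≤ t ℕ.* αone a
  dominant⇒below-tαone t n dominant a = ℤP.drop‿+≤+ (begin
      + n a            ≤⟨ ℤP.0≤i-j⇒j≤i (half twice-gap≥0) ⟩
      + t * + αone a   ≡⟨ sym (pos-* t (αone a)) ⟩
      + (t ℕ.* αone a) ∎)
    where
    open ℤP.≤-Reasoning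
    v : Node → ℤ
    v b = + t * + αone b + -[1+ 0 ] * + n b
    minusOne : ∀ x y → x - y ≡ x + -[1+ 0 ] * y
    minusOne = solve-∀
    coefficient≡cartan : ∀ b → weightCoefficient t n b ≡ cartan v b
    coefficient≡cartan b = begin-equality
        + (t ℕ.* δ b node6) - cartan (λ c → + n c) b
      ≡⟨ cong (_- cartan (λ c → + n c) b) (trans (pos-* t (δ b node6)) (cong (+ t *_) (sym (cartan-αone b)))) ⟩
        + t * cartan (λ c → + αone c) b - cartan (λ c → + n c) b
      ≡⟨ minusOne (+ t * cartan (λ c → + αone c) b) (cartan (λ c → + n c) b) ⟩
        + t * cartan (λ c → + αone c) b + -[1+ 0 ] * cartan (λ c → + n c) b
      ≡⟨ sym (cartan-linear (+ t) (λ c → + αone c) -[1+ 0 ] (λ c → + n c) b) ⟩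
        cartan v b ∎
    nonneg-* : ∀ c {r} → + 0 ≤ r → + 0 ≤ + c * r
    nonneg-* c {+ k} _ = subst (+ 0 ≤_) (pos-* c k) (+≤+ ℕ.z≤n)
    twice-gap≥0 : + 0 ≤ + 2 * (+ t * + αone a - + n a)
    twice-gap≥0 = begin
        + 0
      ≤⟨ sum-nonneg (λ b → nonneg-* (inverseCartan×2 a b) (subst (+ 0 ≤_) (coefficient≡cartan b) (dominant b))) ⟩
        sumNodes (λ b → + inverseCartan×2 a b * cartan v b)
      ≡⟨ inverseCartan×2-cartan v a ⟩
        + 2 * v a
      ≡⟨ cong (+ 2 *_) (sym (minusOne (+ t * + αone a) (+ n a))) ⟩
        + 2 * (+ t * + αone a - + n a) ∎
    half : ∀ {x} → + 0 ≤ + 2 * x → + 0 ≤ x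
    half {+ k} _ = +≤+ ℕ.z≤n
    half { -[1+ k ]} ()

module BoundedSearch where
  open import Data.Nat using (ℕ; zero; suc; _≤_; _<_; s≤s)
  open import Data.Nat.Properties using (allUpTo?)
  open import Data.Fin using (zero; suc)
  open import Data.Vec.Functional using (Vector; []; _∷_; head; tail)
  open import Function using (_∘_)
  open import Relation.Nullary using (Dec)
  open import Relation.Binary.PropositionalEquality using (_≗_; refl)

  AllBelow : ∀ {k} → Vector ℕ k → (Vector ℕ k → Set) → Set
  AllBelow {zero} B P = P []
  AllBelow {suc k} B P = ∀ {x} → x < suc (head B) → AllBelow (tail B) (P ∘ (x ∷_))

  allBelow? : ∀ {k} B {P : Vector ℕ k → Set} → (∀ n → Dec (P n)) → Dec (AllBelow B P)
  allBelow? {zero} B P? = P? []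
  allBelow? {suc k} B P? = allUpTo? (λ x → allBelow? (tail B) (P? ∘ (x ∷_))) (suc (head B))

  AllBelow⇒∀ : ∀ {k} B {P : Vector ℕ k → Set} → (∀ {n m} → n ≗ m → P n → P m) →
    AllBelow B P → ∀ n → (∀ i → n i ≤ B i) → P n
  AllBelow⇒∀ {zero} B resp p n n≤B = resp (λ ()) p
  AllBelow⇒∀ {suc k} B {P} resp p n n≤B =
    resp (λ { zero → refl ; (suc i) → refl })
      (AllBelow⇒∀ (tail B) (λ e → resp (λ { zero → refl ; (suc i) → e i })) (p (s≤s (n≤B zero))) (tail n) (n≤B ∘ suc))

module DominantWeights where
  open import Data.Nat as ℕ using (ℕ; s≤s)
  open import Data.Nat.Properties using (allUpTo?; n≤0⇒n≡0; ≤-trans; ≤-reflexive; +-identityʳ)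
  open import Data.Fin.Properties using (all?)
  open import Data.Integer using (+_; _-_; _≤_; _≤?_)
  open import Data.Product as Product using (_×_)
  open import Data.Sum as Sum using (_⊎_)
  open import Function using (_∘_)
  open import Relation.Nullary using (Dec; ¬_; ¬?; _→-dec_; _×-dec_; _⊎-dec_)
  open import Data.Fin.Properties using () renaming (_≟_ to _≟ᶠ_)
  open import Relation.Binary.PropositionalEquality
  open Cartan
  open BoundedSearch

  zeros : Node → ℕ
  zeros _ = 0

  _≗?_ : (n m : Node → ℕ) → Dec (n ≗ m)
  n ≗? m = all? (λ a → n a ℕ.≟ m a)

  Dominant : ℕ → (Node → ℕ) → Set
  Dominant t n = ∀ a → + 0 ≤ weightCoefficient t n a

  weightCoefficient-cong : ∀ t {n m} → n ≗ m → ∀ a → weightCoefficient t n a ≡ weightCoefficient t m a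
  weightCoefficient-cong t e a = cong (+ (t ℕ.* δ a node6) -_) (cartan-cong (cong +_ ∘ e) a)

  dominant-zero : ∀ n → Dominant 0 n → n ≗ zeros
  dominant-zero n dominant a = n≤0⇒n≡0 (dominant⇒below-tαone 0 n dominant a)

  abstract
    -- The only dominant weights Λ₆ − Σ_b n_b α_b are Λ₆, Λ₁ and 0; checked over the box n ≤ α⁽¹⁾.
    dominant-classification : ∀ n → Dominant 1 n → n ≗ zeros ⊎ n ≗ αtwo ⊎ n ≗ αone
    dominant-classification n dominant = AllBelow⇒∀ αone claim-cong checked n below dominant
      where
      Claim : (Node → ℕ) → Set
      Claim n = Dominant 1 n → n ≗ zeros ⊎ n ≗ αtwo ⊎ n ≗ αone
      claim-cong : ∀ {n m} → n ≗ m → Claim n → Claim m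
      claim-cong {n} {m} e claim dominant =
        Sum.map moved (Sum.map moved moved) (claim (λ a → subst (+ 0 ≤_) (sym (weightCoefficient-cong 1 e a)) (dominant a)))
        where
        moved : ∀ {x} → n ≗ x → m ≗ x
        moved f a = trans (sym (e a)) (f a)
      checked : AllBelow αone Claim
      checked = byComputation (allBelow? αone (λ n →
        all? (λ a → + 0 ≤? weightCoefficient 1 n a) →-dec (n ≗? zeros ⊎-dec n ≗? αtwo ⊎-dec n ≗? αone)))
      below : ∀ a → n a ℕ.≤ αone a
      below a = ≤-trans (dominant⇒below-tαone 1 n dominant a) (≤-reflexive (+-identityʳ (αone a)))

  -- After removing an α⁽²⁾ column the vacancy numbers at node 1 carry an unbounded shift, so node 1 is left out.
  DominantAwayFrom1 : ℕ → (Node → ℕ) → Set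
  DominantAwayFrom1 t n = ∀ a → ¬ a ≡ node1 → + 0 ≤ weightCoefficient t n a

  abstract
    belowαtwo-classification : ∀ t n → t ℕ.≤ 1 → (∀ a → n a ℕ.≤ αtwo a) → DominantAwayFrom1 t n →
      n ≗ zeros ⊎ (t ≡ 1 × n ≗ αtwo)
    belowαtwo-classification t n t≤1 below = AllBelow⇒∀ αtwo claim-cong (checked (s≤s t≤1)) n below
      where
      Claim : ℕ → (Node → ℕ) → Set
      Claim t n = DominantAwayFrom1 t n → n ≗ zeros ⊎ (t ≡ 1 × n ≗ αtwo)
      claim-cong : ∀ {n m} → n ≗ m → Claim t n → Claim t m
      claim-cong {n} {m} e claim dominant =
        Sum.map moved (Product.map₂ moved) (claim (λ a a≢1 → subst (+ 0 ≤_) (sym (weightCoefficient-cong t e a)) (dominant a a≢1)))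
        where
        moved : ∀ {x} → n ≗ x → m ≗ x
        moved f a = trans (sym (e a)) (f a)
      checked : ∀ {t} → t ℕ.< 2 → AllBelow αtwo (Claim t)
      checked = byComputation (allUpTo? (λ t → allBelow? αtwo (λ n →
        all? (λ a → ¬? (a ≟ᶠ node1) →-dec + 0 ≤? weightCoefficient t n a) →-dec
        (n ≗? zeros ⊎-dec (t ℕ.≟ 1 ×-dec n ≗? αtwo)))) 2)

module Vacancies where
  open import Data.Nat as ℕ using (ℕ; suc; _⊓_; z≤n; s≤s)
  import Data.Nat.Properties as ℕP
  open import Data.Integer as ℤ using (ℤ; +_; -[1+_]; _+_; _-_; _*_; _≤_; +≤+)
  import Data.Integer.Properties as ℤP
  open import Data.Integer.Properties using (pos-*; pos-+)
  open import Data.Integer.Tactic.RingSolver using (solve-∀)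
  import Data.Nat.Tactic.RingSolver as ℕ-Solver
  open import Data.List using ([]; _∷_; length)
  open import Data.Nat.ListAction using (sum)
  open import Data.List.Properties using (map-∘; length-map)
  open import Data.List.Relation.Unary.All as All using (All; []; _∷_)
  open import Data.List.Relation.Unary.All.Properties as AllP using ()
  open import Data.List.Extrema.Nat using (argmin; argmin-all; f[argmin]≤f[⊤]; f[argmin]≤f[xs])
  open import Data.Product using (_×_; _,_; proj₁; proj₂)
  open import Function using (_∘_)
  open import Relation.Binary.PropositionalEquality
  open RowLists
  open Cartan

  rowCount : RConf → Node → ℕ
  rowCount ν b = length (ν b)

  minSum≡Q : ∀ i rows → minSum i rows ≡ + Q i (lengths rows)
  minSum≡Q i rows = cong (+_ ∘ sum) (map-∘ rows)

  -- The conditions met by a highest weight element of B^{6,s}, with the vacancy numbers shifted by the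
  -- weight Σ_a e_a Λ_a; removing a first column α⁽²⁾ from ν adds Λ₁ to this shift.
  record Admissible (s : ℕ) (e : Node → ℕ) (ν : RConf) : Set where
    constructor mkAdmissible
    field
      rowsAdmissible : ∀ a → All (λ row → (1 ℕ.≤ proj₁ row) × (+ 0 ≤ vacancy node6 s ν a (proj₁ row) + + e a)) (ν a)
  open Admissible public

  Admissible⇒Positive : ∀ {s e ν} → Admissible s e ν → ∀ b → Positive (ν b)
  Admissible⇒Positive adm b = All.map proj₁ (rowsAdmissible adm b)

  vacancy-firstRow : ∀ s ν a → (∀ b → Positive (ν b)) → vacancy node6 s ν a 1 ≡ weightCoefficient (1 ⊓ s) (rowCount ν) a
  vacancy-firstRow s ν a pos = cong₂ _-_ (cong +_ (ℕP.*-comm (δ a node6) (1 ⊓ s)))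
    (cartan-cong (λ b → trans (minSum≡Q 1 (ν b)) (cong +_ (trans (Q-one (AllP.map⁺ (pos b))) (length-map proj₁ (ν b))))) a)

  -- l p₁ − p_l = (l E₁ − E_l) − Σ_b A_ab D_b with D_b = l Q₁ − Q_l ≥ 0, and D_a = 0 because no row of ν⁽ᵃ⁾ is
  -- shorter than l; only the off-diagonal entries A_ab ≤ 0 remain.
  vacancy-convex : ∀ s (e : Node → ℕ) ν a l → 1 ℕ.≤ l → All (λ row → l ℕ.≤ proj₁ row) (ν a) →
    vacancy node6 s ν a l + + e a ≤ + l * (vacancy node6 s ν a 1 + + e a)
  vacancy-convex s e ν a l 1≤l shortest = begin
      P l + ε
    ≤⟨ ℤP.i≤i+j (P l + ε) gap {{ℤ.nonNegative gap≥0}} ⟩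
      (P l + ε) + gap
    ≡⟨ cong (λ d → (P l + ε) + ((+ l * E 1 - E l) + (+ l * ε - ε) - d))
            (cartan-linear (+ l) (λ b → minSum 1 (ν b)) -[1+ 0 ] (λ b → minSum l (ν b)) a) ⟩
      (P l + ε) + ((+ l * E 1 - E l) + (+ l * ε - ε) - (+ l * C 1 + -[1+ 0 ] * C l))
    ≡⟨ sym (rearrange (+ l) (E 1) (E l) (C 1) (C l) ε) ⟩
      + l * (E 1 - C 1 + ε)
    ≡⟨⟩
      + l * (P 1 + ε) ∎
    where
    open ℤP.≤-Reasoning
    P E C : ℕ → ℤ
    P i = vacancy node6 s ν a i
    E i = + (δ a node6 ℕ.* (i ⊓ s))
    C i = cartan (λ b → minSum i (ν b)) a
    ε : ℤ
    ε = + e a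
    D : Node → ℤ
    D b = + l * minSum 1 (ν b) + -[1+ 0 ] * minSum l (ν b)
    gap : ℤ
    gap = (+ l * E 1 - E l) + (+ l * ε - ε) - cartan D a
    rearrange : ∀ L E1 El C1 Cl ε → L * (E1 - C1 + ε) ≡ (El - Cl + ε) + ((L * E1 - El) + (L * ε - ε) - (L * C1 + -[1+ 0 ] * Cl))
    rearrange = solve-∀
    D≡difference : ∀ b → D b ≡ + (l ℕ.* Q 1 (lengths (ν b))) - + Q l (lengths (ν b))
    D≡difference b = trans (cong₂ (λ x y → + l * x + -[1+ 0 ] * y) (minSum≡Q 1 (ν b)) (minSum≡Q l (ν b)))
                           (cong₂ _+_ (sym (pos-* l _)) (ℤP.-1*i≡-i _))
    D≥0 : ∀ b → + 0 ≤ D b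
    D≥0 b = subst (+ 0 ≤_) (sym (D≡difference b)) (ℤP.i≤j⇒0≤j-i (+≤+ (Q-convex l (lengths (ν b)))))
    Da≡0 : D a ≡ + 0
    Da≡0 = begin-equality
        D a
      ≡⟨ D≡difference a ⟩
        + (l ℕ.* Q 1 (lengths (ν a))) - + Q l (lengths (ν a))
      ≡⟨ cong₂ (λ x y → + (l ℕ.* x) - + y) (Q-one (All.map (ℕP.≤-trans 1≤l) (AllP.map⁺ shortest)))
                                          (Q-below (AllP.map⁺ shortest)) ⟩
        + (l ℕ.* length (lengths (ν a))) - + (l ℕ.* length (lengths (ν a)))
      ≡⟨ ℤP.+-inverseʳ (+ (l ℕ.* length (lengths (ν a)))) ⟩
        + 0 ∎
    gap≥0 : + 0 ≤ gap
    gap≥0 = ℤP.+-mono-≤ (ℤP.+-mono-≤ (ℤP.i≤j⇒0≤j-i E-convex) (ℤP.i≤j⇒0≤j-i ε≤lε))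
                        (ℤP.neg-mono-≤ (cartan-nonpos D≥0 Da≡0))
      where
      E-convex : E l ≤ + l * E 1
      E-convex = subst (E l ≤_) (pos-* l _) (+≤+ (ℕP.≤-trans (ℕP.*-monoʳ-≤ (δ a node6) (⊓-convex l s))
                   (ℕP.≤-reflexive (exchange (δ a node6) l (1 ⊓ s)))))
        where
        exchange : ∀ d l x → d ℕ.* (l ℕ.* x) ≡ l ℕ.* (d ℕ.* x)
        exchange = ℕ-Solver.solve-∀
      ε≤lε : ε ≤ + l * ε
      ε≤lε = subst (ε ≤_) (pos-* l (e a)) (+≤+ (ℕP.m≤n*m (e a) l {{ℕ.>-nonZero 1≤l}}))

  firstRow-nonneg : ∀ {s e ν} → Admissible s e ν → ∀ a → + 0 ≤ vacancy node6 s ν a 1 + + e a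
  firstRow-nonneg {s} {e} {ν} adm a with ν a in eq | rowsAdmissible adm a
  ... | [] | [] = ℤP.+-mono-≤ (ℤP.+-mono-≤ (+≤+ {m = 0} z≤n) (ℤP.neg-mono-≤ C≤0)) (+≤+ z≤n)
    where
    C≤0 : cartan (λ b → minSum 1 (ν b)) a ≤ + 0
    C≤0 = cartan-nonpos {a} {λ b → minSum 1 (ν b)} (λ b → +≤+ z≤n) (cong (minSum 1) eq)
  ... | r ∷ rows | r-ok ∷ rows-ok =
    nonneg-factor (proj₁ shortest-ok)
      (ℤP.≤-trans (proj₂ shortest-ok) (vacancy-convex s e ν a l (proj₁ shortest-ok) (subst (All _) (sym eq) shortest)))
    where
    l : ℕ
    l = proj₁ (argmin proj₁ r rows)
    shortest-ok : (1 ℕ.≤ l) × (+ 0 ≤ vacancy node6 s ν a l + + e a)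
    shortest-ok =
      argmin-all proj₁ {P = λ row → (1 ℕ.≤ proj₁ row) × (+ 0 ≤ vacancy node6 s ν a (proj₁ row) + + e a)} r-ok rows-ok
    shortest : All (λ row → l ℕ.≤ proj₁ row) (r ∷ rows)
    shortest = f[argmin]≤f[⊤] {f = proj₁} r rows ∷ f[argmin]≤f[xs] {f = proj₁} r rows
    nonneg-factor : ∀ {l v} → 1 ℕ.≤ l → + 0 ≤ + l * v → + 0 ≤ v
    nonneg-factor {v = + k} _ _ = +≤+ z≤n
    nonneg-factor {suc l} { -[1+ k ]} _ ()

  peel : RConf → RConf
  peel ν a = peelRows (ν a)

  vacancy-peel : ∀ s ν a i → (∀ b → Positive (ν b)) →
    vacancy node6 (suc s) ν a (suc i) ≡ vacancy node6 s (peel ν) a i + weightCoefficient 1 (rowCount ν) a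
  vacancy-peel s ν a i pos = begin
      + (d ℕ.* suc (i ⊓ s)) - cartan (λ b → minSum (suc i) (ν b)) a
    ≡⟨ cong₂ _-_ (trans (cong +_ (ℕP.*-suc d (i ⊓ s))) (pos-+ d _)) (trans (cartan-cong split a) (cartan-+ rows peeled a)) ⟩
      (+ d + + (d ℕ.* (i ⊓ s))) - (cartan rows a + cartan peeled a)
    ≡⟨ rearrange (+ d) (+ (d ℕ.* (i ⊓ s))) (cartan rows a) (cartan peeled a) ⟩
      (+ (d ℕ.* (i ⊓ s)) - cartan peeled a) + (+ d - cartan rows a)
    ≡⟨ cong (λ m → vacancy node6 s (peel ν) a i + (+ m - cartan rows a)) (sym (ℕP.*-identityˡ d)) ⟩
      vacancy node6 s (peel ν) a i + weightCoefficient 1 (rowCount ν) a ∎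
    where
    open ≡-Reasoning
    d : ℕ
    d = δ a node6
    rows peeled : Node → ℤ
    rows b = + rowCount ν b
    peeled b = minSum i (peel ν b)
    split : ∀ b → minSum (suc i) (ν b) ≡ rows b + peeled b
    split b = begin
        minSum (suc i) (ν b)
      ≡⟨ minSum≡Q (suc i) (ν b) ⟩
        + Q (suc i) (lengths (ν b))
      ≡⟨ cong +_ (Q-peelRows i (pos b)) ⟩
        + (rowCount ν b ℕ.+ Q i (lengths (peel ν b)))
      ≡⟨ pos-+ (rowCount ν b) _ ⟩
        + rowCount ν b + + Q i (lengths (peel ν b))
      ≡⟨ cong (λ m → rows b + m) (sym (minSum≡Q i (peel ν b))) ⟩
        rows b + peeled b ∎
    rearrange : ∀ d x L P → (d + x) - (L + P) ≡ (x - P) + (d - L)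
    rearrange = solve-∀

  Admissible-peel : ∀ {s e f ν} → Admissible (suc s) e ν →
    (∀ a → weightCoefficient 1 (rowCount ν) a + + e a ≡ + f a) → Admissible s f (peel ν)
  Admissible-peel {s} {e} {f} {ν} adm shift = mkAdmissible λ a →
    All-peelRows (rowsAdmissible adm a) (λ row-ok → s≤s z≤n , subst (+ 0 ≤_) (shifted a _) (proj₂ row-ok))
    where
    shifted : ∀ a l → vacancy node6 (suc s) ν a (suc (suc l)) + + e a ≡ vacancy node6 s (peel ν) a (suc l) + + f a
    shifted a l = begin
        vacancy node6 (suc s) ν a (suc (suc l)) + + e a
      ≡⟨ cong (_+ + e a) (vacancy-peel s ν a (suc l) (Admissible⇒Positive adm)) ⟩
        vacancy node6 s (peel ν) a (suc l) + weightCoefficient 1 (rowCount ν) a + + e a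
      ≡⟨ ℤP.+-assoc (vacancy node6 s (peel ν) a (suc l)) _ _ ⟩
        vacancy node6 s (peel ν) a (suc l) + (weightCoefficient 1 (rowCount ν) a + + e a)
      ≡⟨ cong (λ w → vacancy node6 s (peel ν) a (suc l) + w) (shift a) ⟩
        vacancy node6 s (peel ν) a (suc l) + + f a ∎
      where open ≡-Reasoning

module Candidates where
  open import Data.Nat using (ℕ; zero; suc; _+_; _*_; _∸_; _⊓_; _≤_; z≤n; s≤s)
  open import Data.Nat.Properties
  import Data.Nat.Tactic.RingSolver as ℕ-Solver
  open import Data.List using (List; []; _∷_; map; length; _++_; replicate)
  open import Data.List.Relation.Unary.All as All using (All; []; _∷_)
  import Data.List.Relation.Unary.All.Properties as AllP
  open import Data.Product using (_×_; _,_)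
  open import Relation.Binary.PropositionalEquality
  open import Data.Empty using (⊥-elim)
  open RowLists
  open Cartan using (θ; αone≡αtwo+θ)

  columns : ℕ → ℕ → Node → List ℕ
  columns k₁ k₂ a = map (λ β → β a) (replicateL k₁ αone ++ replicateL k₂ αtwo)

  candidateRows : ℕ → ℕ → Node → List ℕ
  candidateRows k₁ k₂ a = rowsFromColumns (columns k₁ k₂ a)

  αtwo≤αone : ∀ a → αtwo a ≤ αone a
  αtwo≤αone a = ≤-trans (m≤m+n (αtwo a) (θ a)) (≤-reflexive (sym (αone≡αtwo+θ a)))

  columns-αtwo : ∀ k₂ a → All (_≤ αtwo a) (columns 0 k₂ a)
  columns-αtwo zero a = []
  columns-αtwo (suc k₂) a = ≤-refl ∷ columns-αtwo k₂ a

  columns-αone : ∀ k₁ k₂ a → All (_≤ αone a) (columns k₁ k₂ a)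
  columns-αone zero k₂ a = All.map (λ h → ≤-trans h (αtwo≤αone a)) (columns-αtwo k₂ a)
  columns-αone (suc k₁) k₂ a = ≤-refl ∷ columns-αone k₁ k₂ a

  Q-rowsFromColumns-cons : ∀ i {c cs} → All (_≤ c) cs → Q (suc i) (rowsFromColumns (c ∷ cs)) ≡ c + Q i (rowsFromColumns cs)
  Q-rowsFromColumns-cons i {c} {cs} hs = begin
      Q (suc i) (rowsFromColumns (c ∷ cs))
    ≡⟨ cong (Q (suc i)) (rowsFromColumns-cons hs) ⟩
      Q (suc i) (map suc (rowsFromColumns cs) ++ replicate (c ∸ maxL cs) 1)
    ≡⟨ Q-addColumn i (rowsFromColumns cs) (c ∸ maxL cs) ⟩
      (length (rowsFromColumns cs) + (c ∸ maxL cs)) + Q i (rowsFromColumns cs)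
    ≡⟨ cong (λ m → (m + (c ∸ maxL cs)) + Q i (rowsFromColumns cs)) (length-rowsFromColumns cs) ⟩
      (maxL cs + (c ∸ maxL cs)) + Q i (rowsFromColumns cs)
    ≡⟨ cong (_+ Q i (rowsFromColumns cs)) (m+[n∸m]≡n (maxL-lub hs)) ⟩
      c + Q i (rowsFromColumns cs) ∎
    where open ≡-Reasoning

  -- ν(k₁[α⁽¹⁾] + k₂[α⁽²⁾]) has, at node a, α⁽²⁾_a rows of length k₁ + k₂ and θ_a rows of length k₁.
  Q-candidateRows : ∀ i k₁ k₂ a → Q i (candidateRows k₁ k₂ a) ≡ αtwo a * (i ⊓ (k₁ + k₂)) + θ a * (i ⊓ k₁)
  Q-candidateRows zero k₁ k₂ a = trans (Q-zero (candidateRows k₁ k₂ a)) (sym (cong₂ _+_ (*-zeroʳ (αtwo a)) (*-zeroʳ (θ a))))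
  Q-candidateRows (suc i) zero zero a = sym (cong₂ _+_ (*-zeroʳ (αtwo a)) (*-zeroʳ (θ a)))
  Q-candidateRows (suc i) zero (suc k₂) a = begin
      Q (suc i) (candidateRows 0 (suc k₂) a)
    ≡⟨ Q-rowsFromColumns-cons i (columns-αtwo k₂ a) ⟩
      αtwo a + Q i (candidateRows 0 k₂ a)
    ≡⟨ cong (αtwo a +_) (Q-candidateRows i 0 k₂ a) ⟩
      αtwo a + (αtwo a * (i ⊓ k₂) + θ a * (i ⊓ 0))
    ≡⟨ cong (λ m → αtwo a + (αtwo a * (i ⊓ k₂) + θ a * m)) (⊓-zeroʳ i) ⟩
      αtwo a + (αtwo a * (i ⊓ k₂) + θ a * 0)
    ≡⟨ addRow (αtwo a) (i ⊓ k₂) (θ a * 0) ⟩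
      αtwo a * suc (i ⊓ k₂) + θ a * 0 ∎
    where
    open ≡-Reasoning
    addRow : ∀ p x y → p + (p * x + y) ≡ p * suc x + y
    addRow = ℕ-Solver.solve-∀
  Q-candidateRows (suc i) (suc k₁) k₂ a = begin
      Q (suc i) (candidateRows (suc k₁) k₂ a)
    ≡⟨ Q-rowsFromColumns-cons i (columns-αone k₁ k₂ a) ⟩
      αone a + Q i (candidateRows k₁ k₂ a)
    ≡⟨ cong₂ _+_ (αone≡αtwo+θ a) (Q-candidateRows i k₁ k₂ a) ⟩
      (αtwo a + θ a) + (αtwo a * (i ⊓ (k₁ + k₂)) + θ a * (i ⊓ k₁))
    ≡⟨ addColumn (αtwo a) (θ a) (i ⊓ (k₁ + k₂)) (i ⊓ k₁) ⟩
      αtwo a * suc (i ⊓ (k₁ + k₂)) + θ a * suc (i ⊓ k₁) ∎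
    where
    open ≡-Reasoning
    addColumn : ∀ p q x y → (p + q) + (p * x + q * y) ≡ p * suc x + q * suc y
    addColumn = ℕ-Solver.solve-∀

  RowBounds : ℕ → ℕ → Node → ℕ → Set
  RowBounds k₁ k₂ a l = (1 ≤ l) × (l ≤ k₁ + k₂) × (αtwo a ≡ 0 → l ≤ k₁)

  candidateRows-bounds : ∀ k₁ k₂ a → All (RowBounds k₁ k₂ a) (candidateRows k₁ k₂ a)
  candidateRows-bounds zero zero a = []
  candidateRows-bounds zero (suc k₂) a = subst (All (RowBounds 0 (suc k₂) a)) (sym (rowsFromColumns-cons (columns-αtwo k₂ a)))
    (AllP.++⁺ (AllP.map⁺ (All.map longer (candidateRows-bounds 0 k₂ a))) (ones (αtwo a) (maxL (columns 0 k₂ a))))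
    where
    longer : ∀ {l} → RowBounds 0 k₂ a l → RowBounds 0 (suc k₂) a (suc l)
    longer (1≤l , l≤k₂ , h) = s≤s z≤n , s≤s l≤k₂ , λ α≡0 → ⊥-elim (<-irrefl refl (≤-trans 1≤l (h α≡0)))
    ones : ∀ n m → All (λ l → (1 ≤ l) × (l ≤ suc k₂) × (n ≡ 0 → l ≤ 0)) (replicate (n ∸ m) 1)
    ones zero zero = []
    ones zero (suc m) = []
    ones (suc n) m = AllP.replicate⁺ (suc n ∸ m) (s≤s z≤n , s≤s z≤n , λ ())
  candidateRows-bounds (suc k₁) k₂ a = subst (All (RowBounds (suc k₁) k₂ a)) (sym (rowsFromColumns-cons (columns-αone k₁ k₂ a)))
    (AllP.++⁺ (AllP.map⁺ (All.map longer (candidateRows-bounds k₁ k₂ a)))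
              (AllP.replicate⁺ _ (s≤s z≤n , s≤s z≤n , λ _ → s≤s z≤n)))
    where
    longer : ∀ {l} → RowBounds k₁ k₂ a l → RowBounds (suc k₁) k₂ a (suc l)
    longer (1≤l , l≤K , h) = s≤s z≤n , s≤s l≤K , λ α≡0 → s≤s (h α≡0)

module ShapeVacancies where
  open import Data.Nat as ℕ using (ℕ; _⊓_)
  import Data.Nat.Properties as ℕP
  open import Data.Integer using (+_; _+_; _-_; _*_)
  import Data.Integer.Properties as ℤP
  open import Data.Integer.Properties using (pos-*; pos-+)
  open import Data.Integer.Tactic.RingSolver using (solve-∀)
  open import Data.Fin.Properties using (all?)
  open import Data.List.Relation.Binary.Permutation.Propositional using (_↭_)
  open import Data.Product using (_,_)
  open import Data.Sum using (_⊎_; inj₁; inj₂)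
  open import Relation.Nullary using (_⊎-dec_)
  open import Relation.Binary.PropositionalEquality
  open RowLists
  open Cartan
  open Vacancies using (minSum≡Q)
  open Candidates

  record Shape (k₁ k₂ : ℕ) (ν : RConf) : Set where
    constructor mkShape
    field
      rowLengths : ∀ a → lengths (ν a) ↭ candidateRows k₁ k₂ a
  open Shape public

  minSum-Shape : ∀ {k₁ k₂ ν} → Shape k₁ k₂ ν → ∀ i b →
    minSum i (ν b) ≡ + (i ⊓ (k₁ ℕ.+ k₂)) * + αtwo b + + (i ⊓ k₁) * + θ b
  minSum-Shape {k₁} {k₂} {ν} shape i b = begin
      minSum i (ν b)
    ≡⟨ minSum≡Q i (ν b) ⟩
      + Q i (lengths (ν b))
    ≡⟨ cong +_ (trans (Q-↭ i (rowLengths shape b)) (Q-candidateRows i k₁ k₂ b)) ⟩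
      + (αtwo b ℕ.* (i ⊓ (k₁ ℕ.+ k₂)) ℕ.+ θ b ℕ.* (i ⊓ k₁))
    ≡⟨ pos-+ (αtwo b ℕ.* (i ⊓ (k₁ ℕ.+ k₂))) (θ b ℕ.* (i ⊓ k₁)) ⟩
      + (αtwo b ℕ.* (i ⊓ (k₁ ℕ.+ k₂))) + + (θ b ℕ.* (i ⊓ k₁))
    ≡⟨ cong₂ _+_ (trans (pos-* (αtwo b) _) (ℤP.*-comm (+ αtwo b) _)) (trans (pos-* (θ b) _) (ℤP.*-comm (+ θ b) _)) ⟩
      + (i ⊓ (k₁ ℕ.+ k₂)) * + αtwo b + + (i ⊓ k₁) * + θ b ∎
    where open ≡-Reasoning

  cartan-minSum-Shape : ∀ {k₁ k₂ ν} → Shape k₁ k₂ ν → ∀ i a →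
    cartan (λ b → minSum i (ν b)) a ≡ + (i ⊓ (k₁ ℕ.+ k₂)) * (+ δ a node6 - + δ a node1) + + (i ⊓ k₁) * + δ a node1
  cartan-minSum-Shape {k₁} {k₂} {ν} shape i a = begin
      cartan (λ b → minSum i (ν b)) a
    ≡⟨ cartan-cong (minSum-Shape shape i) a ⟩
      cartan (λ b → + (i ⊓ (k₁ ℕ.+ k₂)) * + αtwo b + + (i ⊓ k₁) * + θ b) a
    ≡⟨ cartan-linear (+ (i ⊓ (k₁ ℕ.+ k₂))) (λ b → + αtwo b) (+ (i ⊓ k₁)) (λ b → + θ b) a ⟩
      + (i ⊓ (k₁ ℕ.+ k₂)) * cartan (λ b → + αtwo b) a + + (i ⊓ k₁) * cartan (λ b → + θ b) a
    ≡⟨ cong₂ (λ x y → + (i ⊓ (k₁ ℕ.+ k₂)) * x + + (i ⊓ k₁) * y) (cartan-αtwo a) (cartan-θ a) ⟩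
      + (i ⊓ (k₁ ℕ.+ k₂)) * (+ δ a node6 - + δ a node1) + + (i ⊓ k₁) * + δ a node1 ∎
    where open ≡-Reasoning

  node1∉αtwo : ∀ a → δ a node1 ≡ 0 ⊎ αtwo a ≡ 0
  node1∉αtwo = byComputation (all? λ a → (δ a node1 ℕ.≟ 0) ⊎-dec (αtwo a ℕ.≟ 0))

  cartan-minSum-row : ∀ {k₁ k₂ ν} → Shape k₁ k₂ ν → ∀ a {l} → RowBounds k₁ k₂ a l →
    cartan (λ b → minSum l (ν b)) a ≡ + δ a node6 * + l
  cartan-minSum-row {k₁} {k₂} {ν} shape a {l} (_ , l≤K , l≤k₁) = begin
      cartan (λ b → minSum l (ν b)) a
    ≡⟨ cartan-minSum-Shape shape l a ⟩
      + (l ⊓ (k₁ ℕ.+ k₂)) * (+ d₆ - + d₁) + + (l ⊓ k₁) * + d₁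
    ≡⟨ cong (λ m → + m * (+ d₆ - + d₁) + + (l ⊓ k₁) * + d₁) (ℕP.m≤n⇒m⊓n≡m l≤K) ⟩
      + l * (+ d₆ - + d₁) + + (l ⊓ k₁) * + d₁
    ≡⟨ collapse (node1∉αtwo a) ⟩
      + d₆ * + l ∎
    where
    open ≡-Reasoning
    d₁ d₆ : ℕ
    d₁ = δ a node1
    d₆ = δ a node6
    collapse : d₁ ≡ 0 ⊎ αtwo a ≡ 0 → + l * (+ d₆ - + d₁) + + (l ⊓ k₁) * + d₁ ≡ + d₆ * + l
    collapse (inj₁ d₁≡0) =
      trans (cong (λ e → + l * (+ d₆ - + e) + + (l ⊓ k₁) * + e) d₁≡0) (cancel (+ d₆) (+ l) (+ (l ⊓ k₁)))
      where
      cancel : ∀ D L M → L * (D - + 0) + M * + 0 ≡ D * L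
      cancel = solve-∀
    collapse (inj₂ α≡0) =
      trans (cong (λ m → + l * (+ d₆ - + d₁) + + m * + d₁) (ℕP.m≤n⇒m⊓n≡m (l≤k₁ α≡0))) (cancel (+ d₆) (+ d₁) (+ l))
      where
      cancel : ∀ D E L → L * (D - E) + L * E ≡ D * L
      cancel = solve-∀

  vacancy-candidateRow : ∀ {k₁ k₂ s ν} → k₁ ℕ.+ k₂ ℕ.≤ s → Shape k₁ k₂ ν → ∀ a {l} → RowBounds k₁ k₂ a l →
    vacancy node6 s ν a l ≡ + 0
  vacancy-candidateRow {s = s} {ν} K≤s shape a {l} bounds@(_ , l≤K , _) = begin
      + (δ a node6 ℕ.* (l ⊓ s)) - cartan (λ b → minSum l (ν b)) a
    ≡⟨ cong₂ (λ m c → + (δ a node6 ℕ.* m) - c) (ℕP.m≤n⇒m⊓n≡m (ℕP.≤-trans l≤K K≤s)) (cartan-minSum-row shape a bounds) ⟩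
      + (δ a node6 ℕ.* l) - + δ a node6 * + l
    ≡⟨ cong (_- + δ a node6 * + l) (pos-* (δ a node6) l) ⟩
      + δ a node6 * + l - + δ a node6 * + l
    ≡⟨ ℤP.+-inverseʳ (+ δ a node6 * + l) ⟩
      + 0 ∎
    where open ≡-Reasoning

module HighestWeightShapes where
  open import Data.Nat using (ℕ; zero; suc; _+_; _*_; _≤_; z≤n; s≤s; _⊓_)
  import Data.Nat.Properties as ℕP
  open import Data.Integer as ℤ using (ℤ; +_)
  import Data.Integer.Properties as ℤP
  open import Data.Integer.Properties using (pos-+)
  open import Data.List using ([]; _∷_)
  open import Data.List.Relation.Binary.Permutation.Propositional using (_↭_; ↭-refl)
  open import Data.Product using (_×_; _,_; ∃₂; ∃)
  open import Data.Sum using (_⊎_; inj₁; inj₂)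
  open import Relation.Binary.PropositionalEquality
  open RowLists
  open Cartan
  open DominantWeights
  open Vacancies
  open Candidates
  open ShapeVacancies

  multipleΛ₁ : ℕ → Node → ℕ
  multipleΛ₁ m a = m * δ a node1

  firstRow-weightCoefficient : ∀ {s e ν} → Admissible s e ν →
    ∀ a → ℤ.+ 0 ℤ.≤ weightCoefficient (1 ⊓ s) (rowCount ν) a ℤ.+ + e a
  firstRow-weightCoefficient {s} {e} {ν} adm a =
    subst (λ v → + 0 ℤ.≤ v ℤ.+ + e a) (vacancy-firstRow s ν a (Admissible⇒Positive adm)) (firstRow-nonneg adm a)

  Admissible⇒Dominant : ∀ {s ν} → Admissible s zeros ν → Dominant (1 ⊓ s) (rowCount ν)
  Admissible⇒Dominant adm a = subst (+ 0 ℤ.≤_) (ℤP.+-identityʳ _) (firstRow-weightCoefficient adm a)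

  Admissible⇒DominantAwayFrom1 : ∀ {s m ν} → Admissible s (multipleΛ₁ m) ν → DominantAwayFrom1 (1 ⊓ s) (rowCount ν)
  Admissible⇒DominantAwayFrom1 {s} {m} {ν} adm a a≢1 = subst (+ 0 ℤ.≤_) noShift (firstRow-weightCoefficient adm a)
    where
    w : ℤ
    w = weightCoefficient (1 ⊓ s) (rowCount ν) a
    noShift : w ℤ.+ + (m * δ a node1) ≡ w
    noShift = trans (cong (λ d → w ℤ.+ + (m * d)) (δ-≢-node1 a a≢1))
                    (trans (cong (λ x → w ℤ.+ + x) (ℕP.*-zeroʳ m)) (ℤP.+-identityʳ w))

  peel-αone : ∀ {s e ν} → rowCount ν ≗ αone → Admissible (suc s) e ν → Admissible s e (peel ν)
  peel-αone {e = e} counts adm = Admissible-peel adm (λ a →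
    trans (cong (ℤ._+ + e a) (trans (weightCoefficient-cong 1 counts a) (weightCoefficient-αone a))) (ℤP.+-identityˡ _))

  peel-αtwo : ∀ {s m ν} → rowCount ν ≗ αtwo → Admissible (suc s) (multipleΛ₁ m) ν →
    Admissible s (multipleΛ₁ (suc m)) (peel ν)
  peel-αtwo {m = m} counts adm = Admissible-peel adm (λ a →
    trans (cong (ℤ._+ + (m * δ a node1)) (trans (weightCoefficient-cong 1 counts a) (weightCoefficient-αtwo a)))
          (sym (pos-+ (δ a node1) (m * δ a node1))))

  Shape-empty : ∀ {ν} → rowCount ν ≗ zeros → Shape 0 0 ν
  Shape-empty {ν} empty = mkShape rowsEmpty
    where
    rowsEmpty : ∀ a → lengths (ν a) ↭ []
    rowsEmpty a with ν a | empty a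
    ... | [] | _ = ↭-refl
    ... | _ ∷ _ | ()

  unpeel-αone : ∀ {s e ν k₁ k₂} → Admissible (suc s) e ν → rowCount ν ≗ αone →
    Shape k₁ k₂ (peel ν) → Shape (suc k₁) k₂ ν
  unpeel-αone {k₁ = k₁} {k₂} adm counts shape =
    mkShape λ a → unpeel (Admissible⇒Positive adm a) (counts a) (columns-αone k₁ k₂ a) (rowLengths shape a)

  unpeel-αtwo : ∀ {s e ν k₂} → Admissible (suc s) e ν → rowCount ν ≗ αtwo →
    Shape 0 k₂ (peel ν) → Shape 0 (suc k₂) ν
  unpeel-αtwo {k₂ = k₂} adm counts shape =
    mkShape λ a → unpeel (Admissible⇒Positive adm a) (counts a) (columns-αtwo k₂ a) (rowLengths shape a)

  shape-after-αtwo : ∀ s m ν → Admissible s (multipleΛ₁ m) ν → (∀ a → rowCount ν a ≤ αtwo a) →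
    ∃ λ k₂ → k₂ ≤ s × Shape 0 k₂ ν
  shape-after-αtwo zero m ν adm below =
    0 , z≤n , Shape-empty (noColumn (belowαtwo-classification 0 (rowCount ν) z≤n below (Admissible⇒DominantAwayFrom1 {0} {m} adm)))
    where
    noColumn : rowCount ν ≗ zeros ⊎ (0 ≡ 1 × rowCount ν ≗ αtwo) → rowCount ν ≗ zeros
    noColumn (inj₁ empty) = empty
    noColumn (inj₂ (() , _))
  shape-after-αtwo (suc s) m ν adm below =
    byColumn (belowαtwo-classification 1 (rowCount ν) (s≤s z≤n) below (Admissible⇒DominantAwayFrom1 {suc s} {m} adm))
    where
    byColumn : rowCount ν ≗ zeros ⊎ (1 ≡ 1 × rowCount ν ≗ αtwo) → ∃ λ k₂ → k₂ ≤ suc s × Shape 0 k₂ ν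
    byColumn (inj₁ empty) = 0 , z≤n , Shape-empty empty
    byColumn (inj₂ (_ , counts)) =
      let k₂ , k₂≤s , shape = shape-after-αtwo s (suc m) (peel ν) (peel-αtwo {s} {m} counts adm)
                                (λ a → ℕP.≤-trans (length-peelRows (ν a)) (below a))
      in suc k₂ , s≤s k₂≤s , unpeel-αtwo adm counts shape

  shape-of-admissible : ∀ s ν → Admissible s zeros ν → ∃₂ λ k₁ k₂ → k₁ + k₂ ≤ s × Shape k₁ k₂ ν
  shape-of-admissible zero ν adm = 0 , 0 , z≤n , Shape-empty (dominant-zero (rowCount ν) (Admissible⇒Dominant adm))
  shape-of-admissible (suc s) ν adm = byColumn (dominant-classification (rowCount ν) (Admissible⇒Dominant adm))
    where
    byColumn : rowCount ν ≗ zeros ⊎ rowCount ν ≗ αtwo ⊎ rowCount ν ≗ αone →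
      ∃₂ λ k₁ k₂ → k₁ + k₂ ≤ suc s × Shape k₁ k₂ ν
    byColumn (inj₁ empty) = 0 , 0 , z≤n , Shape-empty empty
    byColumn (inj₂ (inj₁ counts)) =
      let k₂ , k₂≤s , shape = shape-after-αtwo s 1 (peel ν) (peel-αtwo {s} {0} counts adm)
                                (λ a → ℕP.≤-trans (length-peelRows (ν a)) (ℕP.≤-reflexive (counts a)))
      in 0 , suc k₂ , s≤s k₂≤s , unpeel-αtwo adm counts shape
    byColumn (inj₂ (inj₂ counts)) =
      let k₁ , k₂ , K≤s , shape = shape-of-admissible s (peel ν) (peel-αone {s} {zeros} counts adm)
      in suc k₁ , k₂ , s≤s K≤s , unpeel-αone adm counts shape

module CandidateStatistics where
  open import Data.Nat as ℕ using (ℕ; _⊓_; _∸_)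
  import Data.Nat.Properties as ℕP
  import Data.Nat.Tactic.RingSolver as ℕ-Solver
  open import Data.Nat.DivMod using (m*n/n≡m)
  open import Data.Integer using (ℤ; +_; _+_; _-_; _*_)
  open import Data.Integer.DivMod using (_/ℕ_)
  import Data.Integer.Properties as ℤP
  open import Data.Integer.Properties using (pos-*; pos-+; +-*-semiring)
  open import Data.Integer.Tactic.RingSolver using (solve-∀)
  open import Algebra.Properties.Semiring.Sum +-*-semiring using (sum; sum-cong-≗; ∑-distrib-+)
  open import Data.List using (List; []; _∷_; map)
  open import Data.List.Relation.Unary.All as All using (All; []; _∷_)
  import Data.List.Relation.Unary.All.Properties as AllP
  open import Data.List.Relation.Binary.Permutation.Propositional using (↭-reflexive)
  open import Data.Product using (_,_; proj₁; proj₂)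
  open import Function using (_∘_)
  open import Relation.Binary.PropositionalEquality
  open RowLists
  open Cartan
  open Vacancies using (minSum≡Q)
  open Candidates
  open ShapeVacancies

  sumNodes-sumℤ : ∀ {R : Set} (c : Node → ℤ) (f : Node → R → ℤ) (xs : List R) →
    sumNodes (λ b → c b * sumℤ (map (f b) xs)) ≡ sumℤ (map (λ x → sumNodes (λ b → c b * f b x)) xs)
  sumNodes-sumℤ c f [] = sum-cong-≗ (λ b → ℤP.*-zeroʳ (c b))
  sumNodes-sumℤ c f (x ∷ xs) = begin
      sum (λ b → c b * (f b x + sumℤ (map (f b) xs)))
    ≡⟨ sum-cong-≗ (λ b → ℤP.*-distribˡ-+ (c b) (f b x) (sumℤ (map (f b) xs))) ⟩
      sum (λ b → c b * f b x + c b * sumℤ (map (f b) xs))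
    ≡⟨ ∑-distrib-+ (λ b → c b * f b x) (λ b → c b * sumℤ (map (f b) xs)) ⟩
      sum (λ b → c b * f b x) + sum (λ b → c b * sumℤ (map (f b) xs))
    ≡⟨ cong (λ t → sum (λ b → c b * f b x) + t) (sumNodes-sumℤ c f xs) ⟩
      sum (λ b → c b * f b x) + sumℤ (map (λ x → sumNodes (λ b → c b * f b x)) xs) ∎
    where open ≡-Reasoning

  sumℤ-cong : ∀ {R : Set} {f g : R → ℤ} {xs} → All (λ x → f x ≡ g x) xs → sumℤ (map f xs) ≡ sumℤ (map g xs)
  sumℤ-cong [] = refl
  sumℤ-cong (e ∷ es) = cong₂ _+_ e (sumℤ-cong es)

  sumℤ-rowLengths : ∀ d rows → sumℤ (map (λ row → d * + proj₁ row) rows) ≡ d * + size rows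
  sumℤ-rowLengths d [] = sym (ℤP.*-zeroʳ d)
  sumℤ-rowLengths d ((l , x) ∷ rows) = begin
      d * + l + sumℤ (map (λ row → d * + proj₁ row) rows)
    ≡⟨ cong (λ t → d * + l + t) (sumℤ-rowLengths d rows) ⟩
      d * + l + d * + size rows
    ≡⟨ sym (ℤP.*-distribˡ-+ d (+ l) (+ size rows)) ⟩
      d * (+ l + + size rows)
    ≡⟨ cong (d *_) (sym (pos-+ l (size rows))) ⟩
      d * + size ((l , x) ∷ rows) ∎
    where open ≡-Reasoning

  withZeroRiggings : List ℕ → List Row
  withZeroRiggings = map (λ l → (l , + 0))

  lengths-withZeroRiggings : ∀ ρ → lengths (withZeroRiggings ρ) ≡ ρ
  lengths-withZeroRiggings [] = refl
  lengths-withZeroRiggings (l ∷ ρ) = cong (l ∷_) (lengths-withZeroRiggings ρ)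

  Shape-candidate : ∀ k₁ k₂ → Shape k₁ k₂ (candidate k₁ k₂)
  Shape-candidate k₁ k₂ = mkShape λ a → ↭-reflexive (lengths-withZeroRiggings (candidateRows k₁ k₂ a))

  candidate-rowBounds : ∀ k₁ k₂ a → All (RowBounds k₁ k₂ a ∘ proj₁) (candidate k₁ k₂ a)
  candidate-rowBounds k₁ k₂ a = AllP.map⁺ (candidateRows-bounds k₁ k₂ a)

  minSum-candidate-size : ∀ k₁ k₂ a → minSum (k₁ ℕ.+ k₂) (candidate k₁ k₂ a) ≡ + size (candidate k₁ k₂ a)
  minSum-candidate-size k₁ k₂ a = trans (minSum≡Q (k₁ ℕ.+ k₂) (candidate k₁ k₂ a))
    (cong +_ (Q-atMost (AllP.map⁺ (All.map (proj₁ ∘ proj₂) (candidate-rowBounds k₁ k₂ a)))))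

  size-candidate-node6 : ∀ k₁ k₂ → + size (candidate k₁ k₂ node6) ≡ + (k₁ ℕ.+ k₂) * + 2 + + k₁ * + 2
  size-candidate-node6 k₁ k₂ = begin
      + size (candidate k₁ k₂ node6)
    ≡⟨ sym (minSum-candidate-size k₁ k₂ node6) ⟩
      minSum K (candidate k₁ k₂ node6)
    ≡⟨ minSum-Shape (Shape-candidate k₁ k₂) K node6 ⟩
      + (K ⊓ K) * + 2 + + (K ⊓ k₁) * + 2
    ≡⟨ cong₂ (λ x y → + x * + 2 + + y * + 2) (ℕP.⊓-idem K) (ℕP.m≥n⇒m⊓n≡n (ℕP.m≤m+n k₁ k₂)) ⟩
      + K * + 2 + + k₁ * + 2 ∎
    where
    open ≡-Reasoning
    K : ℕ
    K = k₁ ℕ.+ k₂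

  weight-candidate : ∀ s k₁ k₂ → k₁ ℕ.+ k₂ ℕ.≤ s → ∀ b → weight node6 s (candidate k₁ k₂) b ≡ targetWeight s k₁ k₂ b
  weight-candidate s k₁ k₂ K≤s b = begin
      + (s ℕ.* d₆) - sumNodes (λ a → + size (candidate k₁ k₂ a) * A a b)
    ≡⟨ cong (+ (s ℕ.* d₆) -_) (trans (sum-cong-≗ transpose) (cartan-minSum-Shape (Shape-candidate k₁ k₂) K b)) ⟩
      + (s ℕ.* d₆) - (+ (K ⊓ K) * (+ d₆ - + d₁) + + (K ⊓ k₁) * + d₁)
    ≡⟨ cong₂ (λ x y → + (s ℕ.* d₆) - (+ x * (+ d₆ - + d₁) + + y * + d₁))
             (ℕP.⊓-idem K) (ℕP.m≥n⇒m⊓n≡n (ℕP.m≤m+n k₁ k₂)) ⟩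
      + (s ℕ.* d₆) - (+ K * (+ d₆ - + d₁) + + k₁ * + d₁)
    ≡⟨ cong₂ (λ x y → x - (y * (+ d₆ - + d₁) + + k₁ * + d₁)) (pos-* s d₆) (pos-+ k₁ k₂) ⟩
      + s * + d₆ - ((+ k₁ + + k₂) * (+ d₆ - + d₁) + + k₁ * + d₁)
    ≡⟨ regroup (+ s) (+ k₁) (+ k₂) (+ d₆) (+ d₁) ⟩
      (+ s - (+ k₁ + + k₂)) * + d₆ + + k₂ * + d₁
    ≡⟨ cong (λ x → (+ s - x) * + d₆ + + k₂ * + d₁) (sym (pos-+ k₁ k₂)) ⟩
      (+ s - + K) * + d₆ + + k₂ * + d₁
    ≡⟨ cong (λ x → x * + d₆ + + k₂ * + d₁) (trans (ℤP.m-n≡m⊖n s K) (ℤP.⊖-≥ K≤s)) ⟩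
      + (s ∸ K) * + d₆ + + k₂ * + d₁
    ≡⟨ sym (trans (pos-+ ((s ∸ K) ℕ.* d₆) (k₂ ℕ.* d₁)) (cong₂ _+_ (pos-* (s ∸ K) d₆) (pos-* k₂ d₁))) ⟩
      + ((s ∸ K) ℕ.* d₆ ℕ.+ k₂ ℕ.* d₁) ∎
    where
    open ≡-Reasoning
    K d₁ d₆ : ℕ
    K = k₁ ℕ.+ k₂
    d₁ = δ b node1
    d₆ = δ b node6
    transpose : ∀ a → + size (candidate k₁ k₂ a) * A a b ≡ A b a * minSum K (candidate k₁ k₂ a)
    transpose a = trans (ℤP.*-comm _ (A a b)) (cong₂ _*_ (A-symmetric a b) (sym (minSum-candidate-size k₁ k₂ a)))
    regroup : ∀ S K₁ K₂ D₆ D₁ → S * D₆ - ((K₁ + K₂) * (D₆ - D₁) + K₁ * D₁) ≡ (S - (K₁ + K₂)) * D₆ + K₂ * D₁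
    regroup = solve-∀

  -- The vacancy numbers vanish on the rows of the candidate, so Σ_b A_ab Q_l(ν⁽ᵇ⁾) = δ_{a6} l on each row l.
  quadForm-candidate : ∀ k₁ k₂ → quadForm (candidate k₁ k₂) ≡ + size (candidate k₁ k₂ node6)
  quadForm-candidate k₁ k₂ = begin
      sumNodes (λ a → sumNodes (λ b → A a b * sumℤ (map (λ row → minSum (proj₁ row) (ν b)) (ν a))))
    ≡⟨ sum-cong-≗ (λ a → sumNodes-sumℤ (A a) (λ b row → minSum (proj₁ row) (ν b)) (ν a)) ⟩
      sumNodes (λ a → sumℤ (map (λ row → cartan (λ b → minSum (proj₁ row) (ν b)) a) (ν a)))
    ≡⟨ sum-cong-≗ (λ a → sumℤ-cong (All.map (cartan-minSum-row (Shape-candidate k₁ k₂) a) (candidate-rowBounds k₁ k₂ a))) ⟩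
      sumNodes (λ a → sumℤ (map (λ row → + δ a node6 * + proj₁ row) (ν a)))
    ≡⟨ sum-cong-≗ (λ a → trans (sumℤ-rowLengths (+ δ a node6) (ν a))
                               (cong (λ d → + d * + size (ν a)) (δ-symmetric a node6))) ⟩
      sumNodes (λ a → + δ node6 a * + size (ν a))
    ≡⟨ sum-δ node6 (λ a → + size (ν a)) ⟩
      + size (ν node6) ∎
    where
    open ≡-Reasoning
    ν : RConf
    ν = candidate k₁ k₂

  sumRiggings-candidate : ∀ k₁ k₂ → sumRiggings (candidate k₁ k₂) ≡ + 0
  sumRiggings-candidate k₁ k₂ = sum-cong-≗ (λ a → zeroRiggings (candidateRows k₁ k₂ a))
    where
    zeroRiggings : ∀ ρ → sumℤ (map proj₂ (withZeroRiggings ρ)) ≡ + 0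
    zeroRiggings [] = refl
    zeroRiggings (l ∷ ρ) = trans (ℤP.+-identityˡ _) (zeroRiggings ρ)

  cocharge-candidate : ∀ k₁ k₂ → cocharge (candidate k₁ k₂) ≡ + (2 ℕ.* k₁ ℕ.+ k₂)
  cocharge-candidate k₁ k₂ = begin
      (quadForm (candidate k₁ k₂) /ℕ 2) + sumRiggings (candidate k₁ k₂)
    ≡⟨ cong₂ (λ q r → (q /ℕ 2) + r) (trans (quadForm-candidate k₁ k₂) (trans (size-candidate-node6 k₁ k₂) doubled))
                                    (sumRiggings-candidate k₁ k₂) ⟩
      (+ ((2 ℕ.* k₁ ℕ.+ k₂) ℕ.* 2) /ℕ 2) + + 0
    ≡⟨ cong +_ (trans (ℕP.+-identityʳ _) (m*n/n≡m (2 ℕ.* k₁ ℕ.+ k₂) 2)) ⟩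
      + (2 ℕ.* k₁ ℕ.+ k₂) ∎
    where
    open ≡-Reasoning
    doubled : + (k₁ ℕ.+ k₂) * + 2 + + k₁ * + 2 ≡ + ((2 ℕ.* k₁ ℕ.+ k₂) ℕ.* 2)
    doubled = begin
        + (k₁ ℕ.+ k₂) * + 2 + + k₁ * + 2
      ≡⟨ sym (cong₂ _+_ (pos-* (k₁ ℕ.+ k₂) 2) (pos-* k₁ 2)) ⟩
        + ((k₁ ℕ.+ k₂) ℕ.* 2) + + (k₁ ℕ.* 2)
      ≡⟨ sym (pos-+ ((k₁ ℕ.+ k₂) ℕ.* 2) (k₁ ℕ.* 2)) ⟩
        + ((k₁ ℕ.+ k₂) ℕ.* 2 ℕ.+ k₁ ℕ.* 2)
      ≡⟨ cong +_ (regroup k₁ k₂) ⟩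
        + ((2 ℕ.* k₁ ℕ.+ k₂) ℕ.* 2) ∎
      where
      regroup : ∀ k₁ k₂ → (k₁ ℕ.+ k₂) ℕ.* 2 ℕ.+ k₁ ℕ.* 2 ≡ (2 ℕ.* k₁ ℕ.+ k₂) ℕ.* 2
      regroup = ℕ-Solver.solve-∀

module HighestWeightElements where
  open import Data.Nat as ℕ using (ℕ; z≤n)
  open import Data.Integer using (+_; _≤_; +≤+)
  import Data.Integer.Properties as ℤP
  open import Data.List using ([]; _∷_)
  open import Data.List.Relation.Unary.All as All using (All; []; _∷_)
  import Data.List.Relation.Unary.All.Properties as AllP
  open import Data.List.Relation.Binary.Permutation.Propositional
    using (_↭_; ↭-sym; ↭-trans; ↭-reflexive; module PermutationReasoning)
  open import Data.List.Relation.Binary.Permutation.Propositional.Properties using (map⁺; All-resp-↭)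
  open import Data.Product using (_×_; _,_; proj₁; proj₂; ∃₂)
  open import Function using (_∘_)
  open import Relation.Binary.PropositionalEquality
  open RowLists
  open Vacancies
  open Candidates
  open ShapeVacancies
  open DominantWeights using (zeros)
  open HighestWeightShapes
  open CandidateStatistics

  IsHWRC⇒Admissible : ∀ {s rc} → IsHWRC node6 s rc → Admissible s zeros rc
  IsHWRC⇒Admissible (isRC , nonneg) = mkAdmissible λ a → All.zipWith
    (λ (row-ok , x≥0) → proj₁ row-ok , subst (+ 0 ≤_) (sym (ℤP.+-identityʳ _)) (ℤP.≤-trans x≥0 (proj₂ row-ok)))
    (isRC a , nonneg a)

  rows≡withZeroRiggings : ∀ {rows} → All (λ row → proj₂ row ≡ + 0) rows → rows ≡ withZeroRiggings (lengths rows)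
  rows≡withZeroRiggings [] = refl
  rows≡withZeroRiggings {(l , x) ∷ rows} (refl ∷ zero) = cong ((l , + 0) ∷_) (rows≡withZeroRiggings zero)

  IsHWRC⇒candidate : ∀ s rc → IsHWRC node6 s rc → ∃₂ λ k₁ k₂ → (k₁ ℕ.+ k₂ ℕ.≤ s) × (∀ a → rc a ↭ candidate k₁ k₂ a)
  IsHWRC⇒candidate s rc hw@(isRC , nonneg) =
    let k₁ , k₂ , K≤s , shape = shape-of-admissible s rc (IsHWRC⇒Admissible hw)
    in k₁ , k₂ , K≤s , λ a → begin
         rc a                                     ≡⟨ rows≡withZeroRiggings (riggings-vanish K≤s shape a) ⟩
         withZeroRiggings (lengths (rc a))         ↭⟨ map⁺ (λ l → (l , + 0)) (rowLengths shape a) ⟩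
         withZeroRiggings (candidateRows k₁ k₂ a) ∎
    where
    open PermutationReasoning
    riggings-vanish : ∀ {k₁ k₂} → k₁ ℕ.+ k₂ ℕ.≤ s → Shape k₁ k₂ rc → ∀ a → All (λ row → proj₂ row ≡ + 0) (rc a)
    riggings-vanish {k₁} {k₂} K≤s shape a = All.tabulate λ {row} row∈ →
      ℤP.≤-antisym
        (subst (proj₂ row ≤_) (vacancy-candidateRow K≤s shape a (All.lookup bounds row∈)) (proj₂ (All.lookup (isRC a) row∈)))
        (All.lookup (nonneg a) row∈)
      where
      bounds : All (RowBounds k₁ k₂ a ∘ proj₁) (rc a)
      bounds = AllP.map⁻ (All-resp-↭ (↭-sym (rowLengths shape a)) (candidateRows-bounds k₁ k₂ a))

  candidate⇒IsHWRC : ∀ s rc → ∃₂ (λ k₁ k₂ → (k₁ ℕ.+ k₂ ℕ.≤ s) × (∀ a → rc a ↭ candidate k₁ k₂ a)) → IsHWRC node6 s rc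
  candidate⇒IsHWRC s rc (k₁ , k₂ , K≤s , rc↭) =
    (λ a → All-resp-↭ (↭-sym (rc↭ a)) (rowsValid a)) , (λ a → All-resp-↭ (↭-sym (rc↭ a)) (riggingsNonneg a))
    where
    shape : Shape k₁ k₂ rc
    shape = mkShape λ a → ↭-trans (map⁺ proj₁ (rc↭ a)) (↭-reflexive (lengths-withZeroRiggings (candidateRows k₁ k₂ a)))
    rowsValid : ∀ a → All (λ row → (1 ℕ.≤ proj₁ row) × (proj₂ row ≤ vacancy node6 s rc a (proj₁ row))) (candidate k₁ k₂ a)
    rowsValid a = AllP.map⁺ (All.map (λ bounds → proj₁ bounds , ℤP.≤-reflexive (sym (vacancy-candidateRow K≤s shape a bounds)))
                                     (candidateRows-bounds k₁ k₂ a))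
    riggingsNonneg : ∀ a → All (λ row → + 0 ≤ proj₂ row) (candidate k₁ k₂ a)
    riggingsNonneg a = AllP.map⁺ (All.map (λ _ → +≤+ z≤n) (candidateRows-bounds k₁ k₂ a))

open import Data.Nat using (ℕ; _+_; _≤_; _*_)
open import Data.Integer using (ℤ; +_)
open import Data.Product using (_×_; ∃₂; _,_)
open import Function.Bundles using (_⇔_; mk⇔)
open import Relation.Binary.PropositionalEquality using (_≡_)
open import Data.List.Relation.Binary.Permutation.Propositional using (_↭_)
open HighestWeightElements using (IsHWRC⇒candidate; candidate⇒IsHWRC)
open CandidateStatistics using (weight-candidate; cocharge-candidate)

proposition9p19 : (s : ℕ) → 1 ≤ s →
    ((rc : RConf) → IsHWRC node6 s rc ⇔ ∃₂ (λ k₁ k₂ → (k₁ + k₂ ≤ s) × (∀ a → rc a ↭ candidate k₁ k₂ a)))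
    × ((k₁ k₂ : ℕ) → k₁ + k₂ ≤ s →
        (∀ b → weight node6 s (candidate k₁ k₂) b ≡ targetWeight s k₁ k₂ b)
        × (cocharge (candidate k₁ k₂) ≡ + (2 * k₁ + k₂)))
proposition9p19 s _ =
  (λ rc → mk⇔ (IsHWRC⇒candidate s rc) (candidate⇒IsHWRC s rc)) ,
  (λ k₁ k₂ K≤s → weight-candidate s k₁ k₂ K≤s , cocharge-candidate k₁ k₂)
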